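{- For a countable binary relational structure $\mathbb{X}=\langle\omega,\rho\rangle$ the following are equivalent: (a) $\mathbb{P}(\mathbb{X})=[\omega]^\omega$; (b) $\mathbb{P}(\mathbb{X})$ is dense in $\langle[\omega]^\omega,\subseteq\rangle$; (c) $\mathbb{X}$ is isomorphic to one of: $\langle\omega,\emptyset\rangle$; the complete graph $\langle\omega,\omega^2\setminus\Delta_\omega\rangle$; $\langle\omega,<\rangle$; $\langle\omega,<^{ -1}\rangle$; $\langle\omega,\Delta_\omega\rangle$; $\langle\omega,\omega^2\rangle$; $\langle\omega,\le\rangle$; $\langle\omega,\le^{ -1}\rangle$; (d) $\mathbb{P}(\mathbb{X})$ is somewhere dense in $\langle[\omega]^\omega,\subseteq\rangle$; (e) $\mathcal{I}_{\mathbb{X}}=\mathrm{Fin}$. Moreover, in this case the separative quotient $\mathrm{sq}\langle\mathbb{P}(\mathbb{X}),\subseteq\rangle=(P(\omega)/\mathrm{Fin})^+$ is atomless and $\sigma$-closed.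
   Context: $\mathbb{P}(\mathbb{X})$ is the set of all $A\subseteq\omega$ such that $\langle A,\rho\cap A^2\rangle\cong\mathbb{X}$; $\mathcal{I}_{\mathbb{X}}=\{I\subseteq\omega:\neg\exists A\in\mathbb{P}(\mathbb{X})\ A\subseteq I\}$; $\mathrm{Fin}$ is the ideal of finite subsets of $\omega$; $\Delta_\omega=\{\langle n,n\rangle:n\in\omega\}$; $[\omega]^\omega$ is the set of infinite subsets of $\omega$. A set $S$ is somewhere dense in a poset $\langle P,\le\rangle$ iff there is $p\in P$ such that for every $q\le p$ there is $s\in S$ with $s\le q$. The separative quotient of a poset $\langle P,\le\rangle$ is $P/{=^*}$ ordered by $[p]\trianglelefteq[q]$ iff $p\le^*q$, where $p\le^*q$ iff $\forall r\le p\ \exists s\le r\ s\le q$ and $p=^*q$ iff $p\le^*q\wedge q\le^*p$. $(P(\omega)/\mathrm{Fin})^+$ is the poset of infinite subsets of $\omega$ modulo finite, ordered by almost inclusion. -}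

module Defs where

open import Data.Nat using (ℕ; _≤_; _<_; _<ᵇ_; _≤ᵇ_; _≡ᵇ_)
open import Data.Bool using (Bool; true; false; not)
open import Data.Product using (Σ; ∃; _×_; _,_)
open import Relation.Binary.PropositionalEquality using (_≡_)
open import Relation.Nullary using (¬_; Dec)
open import Function.Bundles using (_⇔_)

-- Classical logic (the paper works in ZFC), as an explicit hypothesis.
LEM : Set₁
LEM = (P : Set) → Dec P

Subset : Set
Subset = ℕ → Bool

Rel : Set
Rel = ℕ → ℕ → Bool

_∈_ : ℕ → Subset → Set
n ∈ A = A n ≡ true

_⊆_ : Subset → Subset → Set
A ⊆ B = ∀ n → n ∈ A → n ∈ B

Infinite : Subset → Set
Infinite A = ∀ n → ∃ λ m → n ≤ m × m ∈ A

Finite : Subset → Set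
Finite A = ∃ λ n → ∀ m → m ∈ A → m < n

_∖_ : Subset → Subset → Subset
(A ∖ B) n with A n | B n
... | true | false = true
... | _    | _     = false

_⊆*_ : Subset → Subset → Set
A ⊆* B = Finite (A ∖ B)

-- An isomorphism of ⟨ω,σ⟩ onto the substructure ⟨A, ρ ∩ A²⟩ of ⟨ω,ρ⟩:
-- a bijection f : ω → A with  σ m n ⇔ ρ (f m) (f n).
IsoOnto : Rel → Rel → Subset → Set
IsoOnto σ ρ A = Σ (ℕ → ℕ) λ f →
    (∀ m → f m ∈ A)
  × (∀ a → a ∈ A → ∃ λ m → f m ≡ a)
  × (∀ m n → f m ≡ f n → m ≡ n)
  × (∀ m n → σ m n ≡ ρ (f m) (f n))

full : Subset
full _ = true

_≅_ : Rel → Rel → Set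
ρ ≅ σ = IsoOnto ρ σ full

ℙ : Rel → Subset → Set
ℙ ρ A = IsoOnto ρ ρ A

Dense : (Subset → Set) → Set
Dense S = ∀ q → Infinite q → ∃ λ s → S s × Infinite s × s ⊆ q

SomewhereDense : (Subset → Set) → Set
SomewhereDense S = ∃ λ p → Infinite p ×
  (∀ q → Infinite q → q ⊆ p → ∃ λ s → S s × Infinite s × s ⊆ q)

Iℙ : Rel → Subset → Set
Iℙ ρ I = ¬ (∃ λ A → ℙ ρ A × A ⊆ I)

ρ-empty ρ-complete ρ-less ρ-greater ρ-diag ρ-full ρ-leq ρ-geq : Rel
ρ-empty    _ _ = false
ρ-complete m n = not (m ≡ᵇ n)
ρ-less     m n = m <ᵇ n
ρ-greater  m n = n <ᵇ m
ρ-diag     m n = m ≡ᵇ n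
ρ-full     _ _ = true
ρ-leq      m n = m ≤ᵇ n
ρ-geq      m n = n ≤ᵇ m

OneOfEight : Rel → Set
OneOfEight ρ = ρ ≅ ρ-empty ⊎' ρ ≅ ρ-complete ⊎' ρ ≅ ρ-less ⊎' ρ ≅ ρ-greater
             ⊎' ρ ≅ ρ-diag ⊎' ρ ≅ ρ-full ⊎' ρ ≅ ρ-leq ⊎' ρ ≅ ρ-geq
  where open import Data.Sum using () renaming (_⊎_ to _⊎'_)

-- Separative quotient of a poset ⟨P, ⊆⟩ (P a family of subsets):
-- p ≤* q  iff  ∀ r ≤ p ∃ s ≤ r, s ≤ q  (r, s ranging over P).
-- Its order on classes [p] is given by ≤*, equality of classes by =*.
_≤*[_]_ : Subset → (Subset → Set) → Subset → Set
p ≤*[ P ] q = ∀ r → P r → r ⊆ p → ∃ λ s → P s × s ⊆ r × s ⊆ q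

SqAtomless : (Subset → Set) → Set
SqAtomless P = ∀ p → P p → ∃ λ q → ∃ λ r → P q × P r × q ≤*[ P ] p × r ≤*[ P ] p
  × ¬ (∃ λ s → P s × s ≤*[ P ] q × s ≤*[ P ] r)

SqσClosed : (Subset → Set) → Set
SqσClosed P = (p : ℕ → Subset) → (∀ n → P (p n))
  → (∀ n → p (Data.Nat.suc n) ≤*[ P ] p n)
  → ∃ λ q → P q × (∀ n → q ≤*[ P ] p n)
  where import Data.Nat

-- sq⟨P,⊆⟩ = (P(ω)/Fin)⁺ : P is exactly [ω]^ω and ≤* coincides with ⊆*
-- (hence also =* coincides with =_Fin, so classes and order agree)
SqIsPωModFin : (Subset → Set) → Set
SqIsPωModFin P = (∀ A → P A ⇔ Infinite A)
  × (∀ p q → P p → P q → (p ≤*[ P ] q) ⇔ (p ⊆* q))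

-- By Ramsey's theorem, applied to ρ, to its converse and to the diagonal, every infinite set
-- contains an infinite H on which ρ m n depends only on whether m < n, m = n or m > n; these
-- eight "order patterns" are exactly the structures of (c).  If ℙ(𝕏) is somewhere dense, an
-- element of ℙ(𝕏) sits inside such an H, so 𝕏 itself is an order pattern.  Conversely, an
-- order pattern is preserved by the increasing enumeration of any infinite set, so every
-- infinite set then belongs to ℙ(𝕏).  Once ℙ(𝕏) = [ω]^ω, the separative order is almost
-- inclusion, and atomlessness and σ-closedness are the familiar facts about P(ω)/Fin: split an
-- infinite set into its even- and odd-indexed elements, and diagonalise through a decreasing
-- sequence.

module Submission where

open import Defs
open import Data.Product using (_×_)
open import Function.Bundles using (_⇔_)

open import Data.Bool using (Bool; true; false; not; _∧_; if_then_else_)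
open import Data.Bool.Properties using (T-≡; ¬-not; not-involutive) renaming (_≟_ to _≟ᵇ_)
open import Data.Fin using (toℕ; fromℕ<)
open import Data.Fin.Properties using (pigeonhole; toℕ-fromℕ<)
open import Data.Nat
  using (ℕ; zero; suc; _+_; _∸_; _⊔_; _≤_; _<_; _≤′_; ≤′-refl; ≤′-step; _<ᵇ_; _≡ᵇ_; _≤ᵇ_; z≤n)
open import Data.Nat.Properties
open import Data.Product using (∃; _,_; proj₁; proj₂)
open import Data.Sum using (inj₁; inj₂)
open import Data.Unit using (⊤; tt)
open import Function.Base using (_∘_; flip)
open import Function.Bundles using (Equivalence; mk⇔)
open import Relation.Binary.Core using (_Preserves_⟶_)
open import Relation.Binary.Definitions using (tri<; tri≈; tri>)
open import Relation.Binary.PropositionalEquality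
  using (_≡_; _≢_; refl; sym; trans; cong; cong₂; subst; module ≡-Reasoning)
open import Relation.Nullary using (¬_; yes; no; contradiction)
open import Relation.Nullary.Decidable using (decidable-stable)

open Equivalence using (to; from)

AgreesOn : Subset → Rel → Rel → Set
AgreesOn A ρ σ = ∀ m n → m ∈ A → n ∈ A → ρ m n ≡ σ m n

AgreesOn-sym : ∀ {A ρ σ} → AgreesOn A ρ σ → AgreesOn A σ ρ
AgreesOn-sym agree m n m∈A n∈A = sym (agree m n m∈A n∈A)

IsoOnto-respʳ : ∀ {σ ρ ρ′ A} → AgreesOn A ρ ρ′ → IsoOnto σ ρ A → IsoOnto σ ρ′ A
IsoOnto-respʳ agree (f , f∈ , f-onto , f-inj , f-rel) =
  f , f∈ , f-onto , f-inj , λ m n → trans (f-rel m n) (agree (f m) (f n) (f∈ m) (f∈ n))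

≅-sym : ∀ {ρ σ} → ρ ≅ σ → σ ≅ ρ
≅-sym {ρ} {σ} (h , _ , h-onto , h-inj , h-rel) = h⁻¹ , (λ _ → refl) , onto , inj , rel
  where
    h⁻¹ : ℕ → ℕ
    h⁻¹ y = proj₁ (h-onto y refl)

    h∘h⁻¹ : ∀ y → h (h⁻¹ y) ≡ y
    h∘h⁻¹ y = proj₂ (h-onto y refl)

    onto : ∀ a → a ∈ full → ∃ λ m → h⁻¹ m ≡ a
    onto a _ = h a , h-inj _ _ (h∘h⁻¹ (h a))

    inj : ∀ m n → h⁻¹ m ≡ h⁻¹ n → m ≡ n
    inj m n eq = trans (sym (h∘h⁻¹ m)) (trans (cong h eq) (h∘h⁻¹ n))

    rel : ∀ m n → σ m n ≡ ρ (h⁻¹ m) (h⁻¹ n)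
    rel m n = sym (trans (h-rel _ _) (cong₂ σ (h∘h⁻¹ m) (h∘h⁻¹ n)))

IsoOnto-∘ʳ : ∀ {ρ σ τ A} → ρ ≅ σ → IsoOnto σ τ A → IsoOnto ρ τ A
IsoOnto-∘ʳ {A = A} (h , _ , h-onto , h-inj , h-rel) (f , f∈ , f-onto , f-inj , f-rel) =
  f ∘ h , f∈ ∘ h , onto , (λ m n → h-inj m n ∘ f-inj (h m) (h n)) ,
  λ m n → trans (h-rel m n) (f-rel (h m) (h n))
  where
    onto : ∀ a → a ∈ A → ∃ λ m → f (h m) ≡ a
    onto a a∈A with k , fk≡a ← f-onto a a∈A with m , hm≡k ← h-onto k refl =
      m , trans (cong f hm≡k) fk≡a

IsoOnto-∘ˡ : ∀ {σ τ ρ A} (g : τ ≅ ρ) → IsoOnto σ τ (A ∘ proj₁ g) → IsoOnto σ ρ A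
IsoOnto-∘ˡ {A = A} (g , _ , g-onto , g-inj , g-rel) (f , f∈ , f-onto , f-inj , f-rel) =
  g ∘ f , f∈ , onto , (λ m n → f-inj m n ∘ g-inj (f m) (f n)) ,
  λ m n → trans (f-rel m n) (g-rel (f m) (f n))
  where
    onto : ∀ a → a ∈ A → ∃ λ m → g (f m) ≡ a
    onto a a∈A with k , gk≡a ← g-onto a refl
               with m , fm≡k ← f-onto k (subst (_∈ A) (sym gk≡a) a∈A) =
      m , trans (cong g fm≡k) gk≡a

≅-from-common-range : ∀ {σ τ ρ A} → IsoOnto σ ρ A → IsoOnto τ ρ A → σ ≅ τ
≅-from-common-range {σ} {τ} {ρ}
  (f , f∈ , f-onto , f-inj , f-rel) (f′ , f′∈ , f′-onto , f′-inj , f′-rel) = g , (λ _ → refl) , onto , inj , rel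
  where
    g : ℕ → ℕ
    g m = proj₁ (f′-onto (f m) (f∈ m))

    f′∘g : ∀ m → f′ (g m) ≡ f m
    f′∘g m = proj₂ (f′-onto (f m) (f∈ m))

    onto : ∀ k → k ∈ full → ∃ λ m → g m ≡ k
    onto k _ with m , fm≡f′k ← f-onto (f′ k) (f′∈ k) = m , f′-inj _ _ (trans (f′∘g m) fm≡f′k)

    inj : ∀ m n → g m ≡ g n → m ≡ n
    inj m n eq = f-inj m n (trans (sym (f′∘g m)) (trans (cong f′ eq) (f′∘g n)))

    rel : ∀ m n → σ m n ≡ τ (g m) (g n)
    rel m n = begin
      σ m n                   ≡⟨ f-rel m n ⟩
      ρ (f m) (f n)           ≡⟨ cong₂ ρ (sym (f′∘g m)) (sym (f′∘g n)) ⟩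
      ρ (f′ (g m)) (f′ (g n)) ≡⟨ sym (f′-rel (g m) (g n)) ⟩
      τ (g m) (g n)           ∎
      where open ≡-Reasoning

StrictlyIncreasing : (ℕ → ℕ) → Set
StrictlyIncreasing f = f Preserves _<_ ⟶ _<_

increasing-by-steps : ∀ {f} → (∀ k → f k < f (suc k)) → StrictlyIncreasing f
increasing-by-steps {f} step {i} {suc j} i<1+j with m<1+n⇒m<n∨m≡n i<1+j
... | inj₁ i<j  = <-trans (increasing-by-steps step i<j) (step j)
... | inj₂ refl = step i

increasing-inflationary : ∀ {f} → StrictlyIncreasing f → ∀ k → k ≤ f k
increasing-inflationary inc zero    = z≤n
increasing-inflationary inc (suc k) = ≤-<-trans (increasing-inflationary inc k) (inc (n<1+n k))

increasing-reflects-≤ : ∀ {f m n} → StrictlyIncreasing f → f m ≤ f n → m ≤ n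
increasing-reflects-≤ inc fm≤fn = ≮⇒≥ (λ n<m → <⇒≱ (inc n<m) fm≤fn)

increasing-reflects-< : ∀ {f m n} → StrictlyIncreasing f → f m < f n → m < n
increasing-reflects-< inc fm<fn =
  ≤∧≢⇒< (increasing-reflects-≤ inc (<⇒≤ fm<fn)) (λ { refl → <-irrefl refl fm<fn })

increasing⇒injective : ∀ {f} → StrictlyIncreasing f → ∀ m n → f m ≡ f n → m ≡ n
increasing⇒injective inc m n eq =
  ≤-antisym (increasing-reflects-≤ inc (≤-reflexive eq))
            (increasing-reflects-≤ inc (≤-reflexive (sym eq)))

<ᵇ-true : ∀ {m n} → m < n → (m <ᵇ n) ≡ true
<ᵇ-true m<n = to T-≡ (<⇒<ᵇ m<n)

<ᵇ-false : ∀ {m n} → n ≤ m → (m <ᵇ n) ≡ false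
<ᵇ-false {m} {n} n≤m = ¬-not (λ m<ᵇn → ≤⇒≯ n≤m (<ᵇ⇒< m n (from T-≡ m<ᵇn)))

≡ᵇ-true : ∀ n → (n ≡ᵇ n) ≡ true
≡ᵇ-true n = to T-≡ (≡⇒≡ᵇ n n refl)

≡ᵇ-false : ∀ {m n} → m ≢ n → (m ≡ᵇ n) ≡ false
≡ᵇ-false {m} {n} m≢n = ¬-not (λ m≡ᵇn → m≢n (≡ᵇ⇒≡ m n (from T-≡ m≡ᵇn)))

≤ᵇ-true : ∀ {m n} → m ≤ n → (m ≤ᵇ n) ≡ true
≤ᵇ-true m≤n = to T-≡ (≤⇒≤ᵇ m≤n)

≤ᵇ-false : ∀ {m n} → n < m → (m ≤ᵇ n) ≡ false
≤ᵇ-false {m} {n} n<m = ¬-not (λ m≤ᵇn → <⇒≱ n<m (≤ᵇ⇒≤ m n (from T-≡ m≤ᵇn)))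

byOrder : Bool → Bool → Bool → Rel
byOrder lt eq gt m n = if m <ᵇ n then lt else if m ≡ᵇ n then eq else gt

byOrder-< : ∀ lt eq gt {m n} → m < n → byOrder lt eq gt m n ≡ lt
byOrder-< lt eq gt m<n rewrite <ᵇ-true m<n = refl

byOrder-≡ : ∀ lt eq gt n → byOrder lt eq gt n n ≡ eq
byOrder-≡ lt eq gt n rewrite <ᵇ-false (≤-refl {n}) | ≡ᵇ-true n = refl

byOrder-> : ∀ lt eq gt {m n} → n < m → byOrder lt eq gt m n ≡ gt
byOrder-> lt eq gt n<m rewrite <ᵇ-false (<⇒≤ n<m) | ≡ᵇ-false (>⇒≢ n<m) = refl

agreesOn-byOrder : ∀ {A ρ lt eq gt}
  → (∀ {m n} → m ∈ A → n ∈ A → m < n → ρ m n ≡ lt)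
  → (∀ {n} → n ∈ A → ρ n n ≡ eq)
  → (∀ {m n} → m ∈ A → n ∈ A → n < m → ρ m n ≡ gt)
  → AgreesOn A ρ (byOrder lt eq gt)
agreesOn-byOrder {lt = lt} {eq} {gt} on< on≡ on> m n m∈A n∈A with <-cmp m n
... | tri< m<n _ _  = trans (on< m∈A n∈A m<n) (sym (byOrder-< lt eq gt m<n))
... | tri≈ _ refl _ = trans (on≡ m∈A) (sym (byOrder-≡ lt eq gt m))
... | tri> _ _ n<m  = trans (on> m∈A n∈A n<m) (sym (byOrder-> lt eq gt n<m))

byOrder-∘-increasing : ∀ {f : ℕ → ℕ} lt eq gt → StrictlyIncreasing f →
  AgreesOn full (λ m n → byOrder lt eq gt (f m) (f n)) (byOrder lt eq gt)
byOrder-∘-increasing {f} lt eq gt inc = agreesOn-byOrder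
  (λ _ _ m<n → byOrder-< lt eq gt (inc m<n))
  (λ {n} _ → byOrder-≡ lt eq gt (f n))
  (λ _ _ n<m → byOrder-> lt eq gt (inc n<m))

empty-byOrder : AgreesOn full ρ-empty (byOrder false false false)
empty-byOrder = agreesOn-byOrder (λ _ _ _ → refl) (λ _ → refl) (λ _ _ _ → refl)

complete-byOrder : AgreesOn full ρ-complete (byOrder true false true)
complete-byOrder = agreesOn-byOrder
  (λ _ _ m<n → cong not (≡ᵇ-false (<⇒≢ m<n))) (λ {n} _ → cong not (≡ᵇ-true n))
  (λ _ _ n<m → cong not (≡ᵇ-false (>⇒≢ n<m)))

less-byOrder : AgreesOn full ρ-less (byOrder true false false)
less-byOrder = agreesOn-byOrder
  (λ _ _ → <ᵇ-true) (λ {n} _ → <ᵇ-false (≤-refl {n})) (λ _ _ → <ᵇ-false ∘ <⇒≤)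

greater-byOrder : AgreesOn full ρ-greater (byOrder false false true)
greater-byOrder = agreesOn-byOrder
  (λ _ _ → <ᵇ-false ∘ <⇒≤) (λ {n} _ → <ᵇ-false (≤-refl {n})) (λ _ _ → <ᵇ-true)

diag-byOrder : AgreesOn full ρ-diag (byOrder false true false)
diag-byOrder = agreesOn-byOrder
  (λ _ _ → ≡ᵇ-false ∘ <⇒≢) (λ {n} _ → ≡ᵇ-true n) (λ _ _ → ≡ᵇ-false ∘ >⇒≢)

full-byOrder : AgreesOn full ρ-full (byOrder true true true)
full-byOrder = agreesOn-byOrder (λ _ _ _ → refl) (λ _ → refl) (λ _ _ _ → refl)

leq-byOrder : AgreesOn full ρ-leq (byOrder true true false)
leq-byOrder = agreesOn-byOrder
  (λ _ _ → ≤ᵇ-true ∘ <⇒≤) (λ {n} _ → ≤ᵇ-true (≤-refl {n})) (λ _ _ → ≤ᵇ-false)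

geq-byOrder : AgreesOn full ρ-geq (byOrder false true true)
geq-byOrder = agreesOn-byOrder
  (λ _ _ → ≤ᵇ-false) (λ {n} _ → ≤ᵇ-true (≤-refl {n})) (λ _ _ → ≤ᵇ-true ∘ <⇒≤)

-- The eight structures of (c) are the byOrder lt eq gt, one for each triple of Booleans.
OrderPattern : Rel → Set
OrderPattern ρ = ∃ λ lt → ∃ λ eq → ∃ λ gt → ρ ≅ byOrder lt eq gt

pattern is-empty i    = inj₁ i
pattern is-complete i = inj₂ (inj₁ i)
pattern is-less i     = inj₂ (inj₂ (inj₁ i))
pattern is-greater i  = inj₂ (inj₂ (inj₂ (inj₁ i)))
pattern is-diag i     = inj₂ (inj₂ (inj₂ (inj₂ (inj₁ i))))
pattern is-full i     = inj₂ (inj₂ (inj₂ (inj₂ (inj₂ (inj₁ i)))))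
pattern is-leq i      = inj₂ (inj₂ (inj₂ (inj₂ (inj₂ (inj₂ (inj₁ i))))))
pattern is-geq i      = inj₂ (inj₂ (inj₂ (inj₂ (inj₂ (inj₂ (inj₂ i))))))

oneOfEight⇒orderPattern : ∀ {ρ} → OneOfEight ρ → OrderPattern ρ
oneOfEight⇒orderPattern (is-empty i)    = _ , _ , _ , IsoOnto-respʳ empty-byOrder i
oneOfEight⇒orderPattern (is-complete i) = _ , _ , _ , IsoOnto-respʳ complete-byOrder i
oneOfEight⇒orderPattern (is-less i)     = _ , _ , _ , IsoOnto-respʳ less-byOrder i
oneOfEight⇒orderPattern (is-greater i)  = _ , _ , _ , IsoOnto-respʳ greater-byOrder i
oneOfEight⇒orderPattern (is-diag i)     = _ , _ , _ , IsoOnto-respʳ diag-byOrder i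
oneOfEight⇒orderPattern (is-full i)     = _ , _ , _ , IsoOnto-respʳ full-byOrder i
oneOfEight⇒orderPattern (is-leq i)      = _ , _ , _ , IsoOnto-respʳ leq-byOrder i
oneOfEight⇒orderPattern (is-geq i)      = _ , _ , _ , IsoOnto-respʳ geq-byOrder i

orderPattern⇒oneOfEight : ∀ {ρ} → OrderPattern ρ → OneOfEight ρ
orderPattern⇒oneOfEight (false , false , false , i) = is-empty (IsoOnto-respʳ (AgreesOn-sym empty-byOrder) i)
orderPattern⇒oneOfEight (true , false , true , i)  = is-complete (IsoOnto-respʳ (AgreesOn-sym complete-byOrder) i)
orderPattern⇒oneOfEight (true , false , false , i) = is-less (IsoOnto-respʳ (AgreesOn-sym less-byOrder) i)
orderPattern⇒oneOfEight (false , false , true , i) = is-greater (IsoOnto-respʳ (AgreesOn-sym greater-byOrder) i)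
orderPattern⇒oneOfEight (false , true , false , i) = is-diag (IsoOnto-respʳ (AgreesOn-sym diag-byOrder) i)
orderPattern⇒oneOfEight (true , true , true , i)   = is-full (IsoOnto-respʳ (AgreesOn-sym full-byOrder) i)
orderPattern⇒oneOfEight (true , true , false , i)  = is-leq (IsoOnto-respʳ (AgreesOn-sym leq-byOrder) i)
orderPattern⇒oneOfEight (false , true , true , i)  = is-geq (IsoOnto-respʳ (AgreesOn-sym geq-byOrder) i)

record LeastFrom (A : Subset) (n m : ℕ) : Set where
  field
    above  : n ≤ m
    member : m ∈ A
    least  : ∀ {k} → n ≤ k → k ∈ A → m ≤ k

least-from-below : ∀ A n d → (d + n) ∈ A → ∃ (LeastFrom A n)
least-from-below A n zero n∈A = n , record { above = ≤-refl ; member = n∈A ; least = λ n≤k _ → n≤k }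
least-from-below A n (suc d) d+n∈A with A n in n∈?A
... | true  = n , record { above = ≤-refl ; member = n∈?A ; least = λ n≤k _ → n≤k }
... | false with m , m-least ← least-from-below A (suc n) d (subst (_∈ A) (sym (+-suc d n)) d+n∈A) =
  m , record { above = <⇒≤ above ; member = member
             ; least = λ n≤k k∈A → least (≤∧≢⇒< n≤k (n∉A k∈A)) k∈A }
  where
    open LeastFrom m-least
    n∉A : ∀ {k} → k ∈ A → n ≢ k
    n∉A k∈A refl with () ← trans (sym n∈?A) k∈A

least-from : ∀ {A} → Infinite A → ∀ n → ∃ (LeastFrom A n)
least-from {A} A-inf n with w , n≤w , w∈A ← A-inf n =
  least-from-below A n (w ∸ n) (subst (_∈ A) (sym (m∸n+n≡m n≤w)) w∈A)

module Enumeration {A : Subset} (A-inf : Infinite A) where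

  private
    next : ℕ → ℕ
    next n = proj₁ (least-from A-inf n)

    next-least : ∀ n → LeastFrom A n (next n)
    next-least n = proj₂ (least-from A-inf n)

  enum : ℕ → ℕ
  enum zero    = next 0
  enum (suc k) = next (suc (enum k))

  enum-∈ : ∀ k → enum k ∈ A
  enum-∈ zero    = LeastFrom.member (next-least 0)
  enum-∈ (suc k) = LeastFrom.member (next-least (suc (enum k)))

  enum-increasing : StrictlyIncreasing enum
  enum-increasing = increasing-by-steps (λ k → LeastFrom.above (next-least (suc (enum k))))

  enum-onto : ∀ a → a ∈ A → ∃ λ k → enum k ≡ a
  enum-onto a a∈A = onto-below a (increasing-inflationary enum-increasing a)
    where
      onto-below : ∀ k → a ≤ enum k → ∃ λ j → enum j ≡ a
      onto-below zero a≤e₀ = 0 , ≤-antisym (LeastFrom.least (next-least 0) z≤n a∈A) a≤e₀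
      onto-below (suc k) a≤eₖ₊₁ with a ≤? enum k
      ... | yes a≤eₖ = onto-below k a≤eₖ
      ... | no  a≰eₖ =
        suc k , ≤-antisym (LeastFrom.least (next-least (suc (enum k))) (≰⇒> a≰eₖ) a∈A) a≤eₖ₊₁

ℙ-byOrder : ∀ {A} lt eq gt → Infinite A → ℙ (byOrder lt eq gt) A
ℙ-byOrder lt eq gt A-inf =
  enum , enum-∈ , enum-onto , increasing⇒injective enum-increasing ,
  λ m n → sym (byOrder-∘-increasing lt eq gt enum-increasing m n refl refl)
  where open Enumeration A-inf

ℙ-agreeing-with-byOrder⇒≅ : ∀ {ρ s lt eq gt} →
  ℙ ρ s → Infinite s → AgreesOn s ρ (byOrder lt eq gt) → ρ ≅ byOrder lt eq gt
ℙ-agreeing-with-byOrder⇒≅ {ρ} {lt = lt} {eq} {gt} s∈ℙ s-inf agree =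
  ≅-from-common-range {ρ = ρ} s∈ℙ (IsoOnto-respʳ (AgreesOn-sym agree) (ℙ-byOrder lt eq gt s-inf))

⊆-refl : ∀ {A} → A ⊆ A
⊆-refl _ n∈A = n∈A

⊆-trans : ∀ {A B C} → A ⊆ B → B ⊆ C → A ⊆ C
⊆-trans A⊆B B⊆C n = B⊆C n ∘ A⊆B n

descending-chain-⊇ : (S : ℕ → ℕ → Set) → (∀ {k y} → S (suc k) y → S k y) →
  ∀ {i j y} → i ≤ j → S j y → S i y
descending-chain-⊇ S step i≤j = go (≤⇒≤′ i≤j)
  where
    go : ∀ {i j y} → i ≤′ j → S j y → S i y
    go ≤′-refl        y∈Sⱼ = y∈Sⱼ
    go (≤′-step i≤′j) y∈Sⱼ = go i≤′j (step y∈Sⱼ)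

_∩_ : Subset → Subset → Subset
(A ∩ B) n = A n ∧ B n

∈-∩⁺ : ∀ {A B n} → n ∈ A → n ∈ B → n ∈ (A ∩ B)
∈-∩⁺ n∈A n∈B = cong₂ _∧_ n∈A n∈B

∈-∩⁻ : ∀ {A B n} → n ∈ (A ∩ B) → n ∈ A × n ∈ B
∈-∩⁻ {A} {B} {n} n∈A∩B with A n | B n
∈-∩⁻ refl | true | true = refl , refl

∈-∖⁺ : ∀ {A B n} → n ∈ A → B n ≡ false → n ∈ (A ∖ B)
∈-∖⁺ {A} {B} {n} n∈A n∉B with A n | B n
∈-∖⁺ refl refl | true | false = refl

∈-∖⁻ : ∀ {A B n} → n ∈ (A ∖ B) → n ∈ A × ¬ n ∈ B
∈-∖⁻ {A} {B} {n} n∈A∖B with A n | B n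
∈-∖⁻ refl | true | false = refl , λ ()

⊆*-intro : ∀ {A B} N → (∀ {m} → N ≤ m → m ∈ A → m ∈ B) → A ⊆* B
⊆*-intro {A} {B} N eventually = N , λ m m∈A∖B →
  let m∈A , m∉B = ∈-∖⁻ {A} {B} m∈A∖B in ≰⇒> (λ N≤m → m∉B (eventually N≤m m∈A))

⊆*-elim : ∀ {A B} → A ⊆* B → ∃ λ N → ∀ {m} → N ≤ m → m ∈ A → m ∈ B
⊆*-elim {A} {B} (N , bounded) = N , eventually
  where
    eventually : ∀ {m} → N ≤ m → m ∈ A → m ∈ B
    eventually {m} N≤m m∈A with B m in m∈?B
    ... | true  = refl
    ... | false = contradiction (bounded m (∈-∖⁺ {A} {B} m∈A m∈?B)) (≤⇒≯ N≤m)

⊆⇒⊆* : ∀ {A B} → A ⊆ B → A ⊆* B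
⊆⇒⊆* A⊆B = ⊆*-intro 0 (λ {m} _ → A⊆B m)

⊆*-refl : ∀ {A} → A ⊆* A
⊆*-refl = ⊆⇒⊆* ⊆-refl

⊆*-trans : ∀ {A B C} → A ⊆* B → B ⊆* C → A ⊆* C
⊆*-trans A⊆*B B⊆*C with N₁ , A⊆B ← ⊆*-elim A⊆*B | N₂ , B⊆C ← ⊆*-elim B⊆*C =
  ⊆*-intro (N₁ ⊔ N₂) λ le → B⊆C (m⊔n≤o⇒n≤o N₁ N₂ le) ∘ A⊆B (m⊔n≤o⇒m≤o N₁ N₂ le)

⊆*-∩ : ∀ {A B C} → A ⊆* B → A ⊆* C → A ⊆* (B ∩ C)
⊆*-∩ {B = B} {C} A⊆*B A⊆*C with N₁ , A⊆B ← ⊆*-elim A⊆*B | N₂ , A⊆C ← ⊆*-elim A⊆*C =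
  ⊆*-intro (N₁ ⊔ N₂) λ le m∈A →
    ∈-∩⁺ {B} {C} (A⊆B (m⊔n≤o⇒m≤o N₁ N₂ le) m∈A) (A⊆C (m⊔n≤o⇒n≤o N₁ N₂ le) m∈A)

⊆*-infinite : ∀ {A B} → Infinite A → A ⊆* B → Infinite B
⊆*-infinite A-inf A⊆*B n with N , A⊆B ← ⊆*-elim A⊆*B with m , n⊔N≤m , m∈A ← A-inf (n ⊔ N) =
  m , m⊔n≤o⇒m≤o n N n⊔N≤m , A⊆B (m⊔n≤o⇒n≤o n N n⊔N≤m) m∈A

⊆-finite : ∀ {A B} → A ⊆ B → Finite B → Finite A
⊆-finite A⊆B (N , bounded) = N , λ m → bounded m ∘ A⊆B m

infinite⇒¬finite : ∀ {A} → Infinite A → ¬ Finite A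
infinite⇒¬finite A-inf (N , bounded) with m , N≤m , m∈A ← A-inf N = <⇒≱ (bounded m m∈A) N≤m

injective-into⇒¬finite : ∀ {A} (f : ℕ → ℕ) →
  (∀ m n → f m ≡ f n → m ≡ n) → (∀ m → f m ∈ A) → ¬ Finite A
injective-into⇒¬finite f f-inj f∈A (N , bounded)
  with i , j , i<j , same ← pigeonhole (n<1+n N) (λ i → fromℕ< (bounded (f (toℕ i)) (f∈A (toℕ i)))) =
  <⇒≢ i<j (f-inj _ _ (begin
    f (toℕ i)  ≡⟨ toℕ-fromℕ< _ ⟨
    toℕ (fromℕ< _) ≡⟨ cong toℕ same ⟩
    toℕ (fromℕ< _) ≡⟨ toℕ-fromℕ< _ ⟩
    f (toℕ j)  ∎))
  where open ≡-Reasoning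

InfinitelyMany : (ℕ → Set) → Set
InfinitelyMany P = ∀ n → ∃ λ m → n ≤ m × P m

OrderPatternWithin : Rel → Subset → Set
OrderPatternWithin ρ A =
  ∃ λ lt → ∃ λ eq → ∃ λ gt → ∃ λ H → H ⊆ A × Infinite H × AgreesOn H ρ (byOrder lt eq gt)

Homogeneous : Rel → Bool → Subset → Set
Homogeneous c b H = ∀ {m n} → m ∈ H → n ∈ H → m < n → c m n ≡ b

module Classical (lem : LEM) where

  stable : ∀ {P : Set} → ¬ ¬ P → P
  stable = decidable-stable (lem _)

  setOf : (ℕ → Set) → Subset
  setOf P n with lem (P n)
  ... | yes _ = true
  ... | no  _ = false

  ∈-setOf⁺ : ∀ {P n} → P n → n ∈ setOf P
  ∈-setOf⁺ {P} {n} Pn with lem (P n)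
  ... | yes _  = refl
  ... | no ¬Pn = contradiction Pn ¬Pn

  ∈-setOf⁻ : ∀ {P n} → n ∈ setOf P → P n
  ∈-setOf⁻ {P} {n} n∈P with lem (P n)
  ... | yes Pn = Pn

  setOf-infinite : ∀ {P} → InfinitelyMany P → Infinite (setOf P)
  setOf-infinite P-inf n with m , n≤m , Pm ← P-inf n = m , n≤m , ∈-setOf⁺ Pm

  ¬infinitelyMany⇒bounded : ∀ {P} → ¬ InfinitelyMany P → ∃ λ N → ∀ m → P m → m < N
  ¬infinitelyMany⇒bounded ¬inf = stable λ unbounded → ¬inf λ n → stable λ none →
    unbounded (n , λ m Pm → ≰⇒> λ n≤m → none (m , n≤m , Pm))

  ¬finite⇒infinite : ∀ {A} → ¬ Finite A → Infinite A
  ¬finite⇒infinite ¬fin = stable (¬fin ∘ ¬infinitelyMany⇒bounded)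

  infinite-pigeonhole : ∀ {P} → InfinitelyMany P → (c : ℕ → Bool) →
    ∃ λ b → InfinitelyMany (λ m → P m × c m ≡ b)
  infinite-pigeonhole {P} P-inf c with lem (InfinitelyMany (λ m → P m × c m ≡ true))
  ... | yes trues = true , trues
  ... | no ¬trues with N , bounded ← ¬infinitelyMany⇒bounded ¬trues = false , falses
    where
      falses : InfinitelyMany (λ m → P m × c m ≡ false)
      falses n with m , n⊔N≤m , Pm ← P-inf (n ⊔ N) =
        m , m⊔n≤o⇒m≤o n N n⊔N≤m , Pm ,
        ¬-not λ cm≡true → <⇒≱ (bounded m (Pm , cm≡true)) (m⊔n≤o⇒n≤o n N n⊔N≤m)

  injective-into⇒infinite : ∀ {A} (f : ℕ → ℕ) →
    (∀ m n → f m ≡ f n → m ≡ n) → (∀ m → f m ∈ A) → Infinite A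
  injective-into⇒infinite f f-inj f∈A = ¬finite⇒infinite (injective-into⇒¬finite f f-inj f∈A)

  ℙ⇒infinite : ∀ {ρ A} → ℙ ρ A → Infinite A
  ℙ⇒infinite (f , f∈A , _ , f-inj , _) = injective-into⇒infinite f f-inj f∈A

  ≅-preimage-infinite : ∀ {σ ρ A} (g : σ ≅ ρ) → Infinite A → Infinite (A ∘ proj₁ g)
  ≅-preimage-infinite {A = A} (g , _ , g-onto , _ , _) A-inf =
    injective-into⇒infinite index index-inj index∈
    where
      open Enumeration A-inf

      index : ℕ → ℕ
      index k = proj₁ (g-onto (enum k) refl)

      g∘index : ∀ k → g (index k) ≡ enum k
      g∘index k = proj₂ (g-onto (enum k) refl)

      index-inj : ∀ i j → index i ≡ index j → i ≡ j
      index-inj i j eq = increasing⇒injective enum-increasing i j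
        (trans (sym (g∘index i)) (trans (cong g eq) (g∘index j)))

      index∈ : ∀ k → g (index k) ∈ A
      index∈ k = subst (_∈ A) (sym (g∘index k)) (enum-∈ k)

  record Thinning (c : Rel) (P : ℕ → Set) : Set₁ where
    field
      head          : ℕ
      colour        : Bool
      tail          : ℕ → Set
      tail-infinite : InfinitelyMany tail
      head-∈        : P head
      tail-⊆        : ∀ {y} → tail y → P y
      tail-coloured : ∀ {y} → tail y → head < y × c head y ≡ colour

  thin : (c : Rel) → ∀ {P} → InfinitelyMany P → Thinning c P
  thin c {P} P-inf = record
    { head          = x
    ; colour        = proj₁ split
    ; tail          = λ y → (P y × x < y) × c x y ≡ proj₁ split
    ; tail-infinite = proj₂ split
    ; head-∈        = proj₂ (proj₂ (P-inf 0))
    ; tail-⊆        = proj₁ ∘ proj₁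
    ; tail-coloured = λ ((_ , x<y) , colour) → x<y , colour
    }
    where
      x : ℕ
      x = proj₁ (P-inf 0)

      above-x : InfinitelyMany (λ y → P y × x < y)
      above-x n with m , n⊔1+x≤m , Pm ← P-inf (n ⊔ suc x) =
        m , m⊔n≤o⇒m≤o n (suc x) n⊔1+x≤m , Pm , m⊔n≤o⇒n≤o n (suc x) n⊔1+x≤m

      split : ∃ λ b → InfinitelyMany (λ y → (P y × x < y) × c x y ≡ b)
      split = infinite-pigeonhole above-x (c x)

  -- Each thinning fixes the colour from its head to everything after it; a colour taken by
  -- infinitely many heads makes those heads homogeneous.
  ramsey : (c : Rel) → ∀ {A} → Infinite A → ∃ λ H → ∃ λ b → H ⊆ A × Infinite H × Homogeneous c b H
  ramsey c {A} A-inf = H , b , H⊆A , H-infinite , H-homogeneous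
    where
      stage : ℕ → ∃ InfinitelyMany
      step  : ∀ k → Thinning c (proj₁ (stage k))
      stage zero    = (_∈ A) , A-inf
      stage (suc k) = Thinning.tail (step k) , Thinning.tail-infinite (step k)
      step k = thin c (proj₂ (stage k))

      x : ℕ → ℕ
      x k = Thinning.head (step k)

      colour : ℕ → Bool
      colour k = Thinning.colour (step k)

      stage-⊇ : ∀ {i j y} → i ≤ j → proj₁ (stage j) y → proj₁ (stage i) y
      stage-⊇ = descending-chain-⊇ (proj₁ ∘ stage) (λ {k} → Thinning.tail-⊆ (step k))

      later-in-tail : ∀ {k j} → k < j → Thinning.tail (step k) (x j)
      later-in-tail {k} {j} k<j = stage-⊇ k<j (Thinning.head-∈ (step j))

      x-increasing : StrictlyIncreasing x
      x-increasing = increasing-by-steps λ k →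
        proj₁ (Thinning.tail-coloured (step k) (later-in-tail {k} {suc k} ≤-refl))

      recurring-colour : ∃ λ b → InfinitelyMany (λ k → ⊤ × colour k ≡ b)
      recurring-colour = infinite-pigeonhole (λ n → n , ≤-refl , tt) colour

      b : Bool
      b = proj₁ recurring-colour

      often-b : InfinitelyMany (λ k → ⊤ × colour k ≡ b)
      often-b = proj₂ recurring-colour

      H : Subset
      H = setOf λ y → ∃ λ k → x k ≡ y × colour k ≡ b

      H⊆A : H ⊆ A
      H⊆A y y∈H with k , refl , _ ← ∈-setOf⁻ y∈H = stage-⊇ {0} {k} z≤n (Thinning.head-∈ (step k))

      H-infinite : Infinite H
      H-infinite n with k , n≤k , _ , colourₖ ← often-b n =
        x k , ≤-trans n≤k (increasing-inflationary x-increasing k) , ∈-setOf⁺ (k , refl , colourₖ)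

      H-homogeneous : Homogeneous c b H
      H-homogeneous m∈H n∈H m<n with k , refl , colourₖ ← ∈-setOf⁻ m∈H | j , refl , _ ← ∈-setOf⁻ n∈H =
        let k<j = increasing-reflects-< x-increasing m<n
        in trans (proj₂ (Thinning.tail-coloured (step k) (later-in-tail {k} {j} k<j))) colourₖ

  orderPatternWithin-infinite : (ρ : Rel) → ∀ {A} → Infinite A → OrderPatternWithin ρ A
  orderPatternWithin-infinite ρ {A} A-inf
    with H₁ , lt , H₁⊆A  , H₁-inf , H₁-hom ← ramsey ρ A-inf
    with H₂ , gt , H₂⊆H₁ , H₂-inf , H₂-hom ← ramsey (flip ρ) H₁-inf
    with eq , diagonal ← infinite-pigeonhole H₂-inf (λ n → ρ n n) =
      lt , eq , gt , H₃ , ⊆-trans H₃⊆H₂ (⊆-trans H₂⊆H₁ H₁⊆A) , setOf-infinite diagonal ,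
      agreesOn-byOrder
        (λ m∈H₃ n∈H₃ → H₁-hom (H₂⊆H₁ _ (H₃⊆H₂ _ m∈H₃)) (H₂⊆H₁ _ (H₃⊆H₂ _ n∈H₃)))
        (λ n∈H₃ → proj₂ (∈-setOf⁻ n∈H₃))
        (λ m∈H₃ n∈H₃ → H₂-hom (H₃⊆H₂ _ n∈H₃) (H₃⊆H₂ _ m∈H₃))
    where
      H₃ : Subset
      H₃ = setOf λ n → n ∈ H₂ × ρ n n ≡ eq

      H₃⊆H₂ : H₃ ⊆ H₂
      H₃⊆H₂ _ = proj₁ ∘ ∈-setOf⁻

  alternating : ℕ → Bool
  alternating zero    = true
  alternating (suc k) = not (alternating k)

  alternating-hits : ∀ b n → ∃ λ k → n ≤ k × alternating k ≡ b
  alternating-hits b n with alternating n ≟ᵇ b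
  ... | yes hit = n , ≤-refl , hit
  ... | no miss = suc n , n≤1+n n , trans (cong not (¬-not miss)) (not-involutive b)

  module Halves {A : Subset} (A-inf : Infinite A) where
    open Enumeration A-inf

    -- the elements of A with even (b = true) or odd (b = false) index in its enumeration
    half : Bool → Subset
    half b = setOf λ y → ∃ λ k → enum k ≡ y × alternating k ≡ b

    half-⊆ : ∀ {b} → half b ⊆ A
    half-⊆ y y∈half with k , refl , _ ← ∈-setOf⁻ y∈half = enum-∈ k

    half-infinite : ∀ b → Infinite (half b)
    half-infinite b n with k , n≤k , alternatesₖ ← alternating-hits b n =
      enum k , ≤-trans n≤k (increasing-inflationary enum-increasing k) , ∈-setOf⁺ (k , refl , alternatesₖ)

    halves-disjoint : ∀ {y} → y ∈ half true → ¬ y ∈ half false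
    halves-disjoint y∈even y∈odd
      with k , refl , evenₖ ← ∈-setOf⁻ y∈even | j , eⱼ≡eₖ , oddⱼ ← ∈-setOf⁻ y∈odd
      with refl ← increasing⇒injective enum-increasing j k eⱼ≡eₖ
      with () ← trans (sym evenₖ) oddⱼ

  pseudo-intersection : (I : ℕ → Subset) → (∀ k → Infinite (I k)) → (∀ k → I (suc k) ⊆ I k) →
    ∃ λ q → Infinite q × ∀ n → q ⊆* I n
  pseudo-intersection I I-inf I-desc = q , q-infinite , q⊆*I
    where
      x : ℕ → ℕ
      x zero    = proj₁ (I-inf 0 0)
      x (suc k) = proj₁ (I-inf (suc k) (suc (x k)))

      x∈I : ∀ k → x k ∈ I k
      x∈I zero    = proj₂ (proj₂ (I-inf 0 0))
      x∈I (suc k) = proj₂ (proj₂ (I-inf (suc k) (suc (x k))))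

      x-increasing : StrictlyIncreasing x
      x-increasing = increasing-by-steps λ k → proj₁ (proj₂ (I-inf (suc k) (suc (x k))))

      q : Subset
      q = setOf λ y → ∃ λ k → x k ≡ y

      q-infinite : Infinite q
      q-infinite n = x n , increasing-inflationary x-increasing n , ∈-setOf⁺ (n , refl)

      q⊆*I : ∀ n → q ⊆* I n
      q⊆*I n = ⊆*-intro (x n) λ xₙ≤y y∈q → later-in-I xₙ≤y (∈-setOf⁻ y∈q)
        where
          later-in-I : ∀ {y} → x n ≤ y → (∃ λ k → x k ≡ y) → y ∈ I n
          later-in-I xₙ≤xₖ (k , refl) =
            descending-chain-⊇ (λ k y → y ∈ I k) (λ {k} {y} → I-desc k y)
              (increasing-reflects-≤ x-increasing xₙ≤xₖ) (x∈I k)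

⊆⇒≤* : ∀ {P p q} → p ⊆ q → p ≤*[ P ] q
⊆⇒≤* p⊆q r r∈P r⊆p = r , r∈P , ⊆-refl , ⊆-trans r⊆p p⊆q

module SeparativeQuotientOfInfiniteSets
  (lem : LEM) (P : Subset → Set) (P⇔infinite : ∀ A → P A ⇔ Infinite A) where

  open Classical lem

  private
    P⇒infinite : ∀ {A} → P A → Infinite A
    P⇒infinite = to (P⇔infinite _)

    infinite⇒P : ∀ {A} → Infinite A → P A
    infinite⇒P = from (P⇔infinite _)

  -- If p ∖ q were infinite, it would be a member of P below p with no member of P below it and q.
  ≤*⇒⊆* : ∀ p q → p ≤*[ P ] q → p ⊆* q
  ≤*⇒⊆* p q p≤*q = stable λ ¬p⊆*q →
    let p∖q⊆p : (p ∖ q) ⊆ p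
        p∖q⊆p _ = proj₁ ∘ ∈-∖⁻ {p} {q}
        s , s∈P , s⊆p∖q , s⊆q = p≤*q (p ∖ q) (infinite⇒P (¬finite⇒infinite ¬p⊆*q)) p∖q⊆p
        m , _ , m∈s = P⇒infinite s∈P 0
    in proj₂ (∈-∖⁻ {p} {q} (s⊆p∖q m m∈s)) (s⊆q m m∈s)

  ⊆*⇒≤* : ∀ p q → p ⊆* q → p ≤*[ P ] q
  ⊆*⇒≤* p q p⊆*q r r∈P r⊆p =
    r ∩ q , infinite⇒P (⊆*-infinite (P⇒infinite r∈P) (⊆*-∩ ⊆*-refl (⊆*-trans (⊆⇒⊆* r⊆p) p⊆*q))) ,
    (λ _ → proj₁ ∘ ∈-∩⁻ {r} {q}) , (λ _ → proj₂ ∘ ∈-∩⁻ {r} {q})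

  sq-is-Pω/Fin : SqIsPωModFin P
  sq-is-Pω/Fin = P⇔infinite , λ p q _ _ → mk⇔ (≤*⇒⊆* p q) (⊆*⇒≤* p q)

  sq-atomless : SqAtomless P
  sq-atomless p p∈P =
    half true , half false , infinite⇒P (half-infinite true) , infinite⇒P (half-infinite false) ,
    ⊆⇒≤* half-⊆ , ⊆⇒≤* half-⊆ , no-common-lower-bound
    where
      open Halves (P⇒infinite p∈P)

      no-common-lower-bound : ¬ (∃ λ s → P s × s ≤*[ P ] half true × s ≤*[ P ] half false)
      no-common-lower-bound (s , s∈P , s≤*even , s≤*odd)
        with y , _ , y∈both ←
               ⊆*-infinite (P⇒infinite s∈P) (⊆*-∩ (≤*⇒⊆* _ _ s≤*even) (≤*⇒⊆* _ _ s≤*odd)) 0 =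
        let y∈even , y∈odd = ∈-∩⁻ {half true} {half false} y∈both in halves-disjoint y∈even y∈odd

  -- The intersections p₀ ∩ … ∩ pₖ are infinite, being almost equal to pₖ.
  sq-σ-closed : SqσClosed P
  sq-σ-closed p p∈P p-desc =
    let q , q-inf , q⊆*I = pseudo-intersection I I-infinite I-desc
    in q , infinite⇒P q-inf , λ n → ⊆*⇒≤* q (p n) (⊆*-trans (q⊆*I n) (⊆⇒⊆* (I⊆p n)))
    where
      I : ℕ → Subset
      I zero    = p zero
      I (suc k) = I k ∩ p (suc k)

      p⊆*I : ∀ k → p k ⊆* I k
      p⊆*I zero    = ⊆*-refl
      p⊆*I (suc k) = ⊆*-∩ (⊆*-trans (≤*⇒⊆* _ _ (p-desc k)) (p⊆*I k)) ⊆*-refl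

      I-infinite : ∀ k → Infinite (I k)
      I-infinite k = ⊆*-infinite (P⇒infinite (p∈P k)) (p⊆*I k)

      I-desc : ∀ k → I (suc k) ⊆ I k
      I-desc k _ = proj₁ ∘ ∈-∩⁻ {I k} {p (suc k)}

      I⊆p : ∀ k → I k ⊆ p k
      I⊆p zero    = ⊆-refl
      I⊆p (suc k) _ = proj₂ ∘ ∈-∩⁻ {I k} {p (suc k)}

dense⇒somewhereDense : ∀ {S} → Dense S → SomewhereDense S
dense⇒somewhereDense dense = full , (λ n → n , ≤-refl , refl) , λ q q-inf _ → dense q q-inf

module Characterisation (lem : LEM) (ρ : Rel) where

  open Classical lem

  ℙ≐Infinite : Set
  ℙ≐Infinite = ∀ A → ℙ ρ A ⇔ Infinite A

  ℙ≐Infinite⇒dense : ℙ≐Infinite → Dense (ℙ ρ)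
  ℙ≐Infinite⇒dense all q q-inf = q , from (all q) q-inf , q-inf , ⊆-refl

  somewhereDense⇒orderPattern : SomewhereDense (ℙ ρ) → OrderPattern ρ
  somewhereDense⇒orderPattern (p , p-inf , dense-below-p) =
    from-pattern-subset (orderPatternWithin-infinite ρ p-inf)
    where
      from-pattern-subset : OrderPatternWithin ρ p → OrderPattern ρ
      from-pattern-subset (lt , eq , gt , H , H⊆p , H-inf , agree)
        with s , s∈ℙ , s-inf , s⊆H ← dense-below-p H H-inf H⊆p =
        lt , eq , gt ,
        ℙ-agreeing-with-byOrder⇒≅ s∈ℙ s-inf (λ m n m∈s n∈s → agree m n (s⊆H m m∈s) (s⊆H n n∈s))

  orderPattern⇒ℙ≐Infinite : OrderPattern ρ → ℙ≐Infinite
  orderPattern⇒ℙ≐Infinite (lt , eq , gt , h) A = mk⇔ ℙ⇒infinite λ A-inf →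
    IsoOnto-∘ˡ {ρ = ρ} h⁻¹
      (IsoOnto-∘ʳ {τ = byOrder lt eq gt} h (ℙ-byOrder lt eq gt (≅-preimage-infinite {ρ = ρ} h⁻¹ A-inf)))
    where
      h⁻¹ : byOrder lt eq gt ≅ ρ
      h⁻¹ = ≅-sym h

  ℙ≐Infinite⇒Iℙ≐Finite : ℙ≐Infinite → ∀ I → Iℙ ρ I ⇔ Finite I
  ℙ≐Infinite⇒Iℙ≐Finite all I = mk⇔ Iℙ⇒finite finite⇒Iℙ
    where
      Iℙ⇒finite : Iℙ ρ I → Finite I
      Iℙ⇒finite I∈Iℙ = stable λ ¬I-fin → I∈Iℙ (I , from (all I) (¬finite⇒infinite ¬I-fin) , ⊆-refl)

      finite⇒Iℙ : Finite I → Iℙ ρ I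
      finite⇒Iℙ I-fin (A , A∈ℙ , A⊆I) = infinite⇒¬finite (ℙ⇒infinite A∈ℙ) (⊆-finite A⊆I I-fin)

  Iℙ≐Finite⇒dense : (∀ I → Iℙ ρ I ⇔ Finite I) → Dense (ℙ ρ)
  Iℙ≐Finite⇒dense Iℙ≐Finite q q-inf =
    let A , A∈ℙ , A⊆q = stable λ q∈Iℙ → infinite⇒¬finite q-inf (to (Iℙ≐Finite q) q∈Iℙ)
    in A , A∈ℙ , ℙ⇒infinite A∈ℙ , A⊆q

theorem6p1 : LEM → (ρ : Rel) →
    ((∀ A → ℙ ρ A ⇔ Infinite A) ⇔ Dense (ℙ ρ))
    × ((∀ A → ℙ ρ A ⇔ Infinite A) ⇔ OneOfEight ρ)
    × ((∀ A → ℙ ρ A ⇔ Infinite A) ⇔ SomewhereDense (ℙ ρ))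
    × ((∀ A → ℙ ρ A ⇔ Infinite A) ⇔ (∀ I → Iℙ ρ I ⇔ Finite I))
    × ((∀ A → ℙ ρ A ⇔ Infinite A) →
    SqIsPωModFin (ℙ ρ) × SqAtomless (ℙ ρ) × SqσClosed (ℙ ρ))
theorem6p1 lem ρ =
    mk⇔ ℙ≐Infinite⇒dense (somewhereDense⇒ℙ≐Infinite ∘ dense⇒somewhereDense)
  , mk⇔ (orderPattern⇒oneOfEight ∘ somewhereDense⇒orderPattern ∘ ℙ≐Infinite⇒somewhereDense)
        (orderPattern⇒ℙ≐Infinite ∘ oneOfEight⇒orderPattern)
  , mk⇔ ℙ≐Infinite⇒somewhereDense somewhereDense⇒ℙ≐Infinite
  , mk⇔ ℙ≐Infinite⇒Iℙ≐Finite (somewhereDense⇒ℙ≐Infinite ∘ dense⇒somewhereDense ∘ Iℙ≐Finite⇒dense)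
  , separative-quotient
  where
    open Characterisation lem ρ

    ℙ≐Infinite⇒somewhereDense : ℙ≐Infinite → SomewhereDense (ℙ ρ)
    ℙ≐Infinite⇒somewhereDense = dense⇒somewhereDense ∘ ℙ≐Infinite⇒dense

    somewhereDense⇒ℙ≐Infinite : SomewhereDense (ℙ ρ) → ℙ≐Infinite
    somewhereDense⇒ℙ≐Infinite = orderPattern⇒ℙ≐Infinite ∘ somewhereDense⇒orderPattern

    separative-quotient : ℙ≐Infinite → SqIsPωModFin (ℙ ρ) × SqAtomless (ℙ ρ) × SqσClosed (ℙ ρ)
    separative-quotient all = sq-is-Pω/Fin , sq-atomless , sq-σ-closed
      where open SeparativeQuotientOfInfiniteSets lem (ℙ ρ) all
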